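{- The family $\sigma=(\sigma_A)_A$, indexed by Heyting algebras, is a natural transformation $\mathrm{pf}\circ\mathsf{L}^\triangle\to\mathsf{M}\circ\mathrm{pf}'$, and $(\rho^\triangle)^\flat_A\circ\sigma_A=\mathrm{id}_{\mathrm{pf}(\mathsf{L}^\triangle A)}$ for every Heyting algebra $A$.
   Context: For a poset $(X,\le)$, $\mathsf{M}(X,\le)$ is the set of families $W$ of upsets of $(X,\le)$ such that $a\in W$ and $a\subseteq b$ with $b$ an upset imply $b\in W$, ordered by inclusion; for a p-morphism $f:(X_1,\le_1)\to(X_2,\le_2)$, $\mathsf{M}f(W)=\{a_2\text{ upset of }X_2\mid f^{ -1}(a_2)\in W\}$. For a Heyting algebra $A$, $\mathsf{L}^\triangle A$ is the distributive lattice freely generated by symbols $\dot\triangle a$ ($a\in A$) modulo $\dot\triangle(a\wedge b)\le\dot\triangle a$; $\mathsf{L}^\triangle h(\dot\triangle a)=\dot\triangle h(a)$. $\mathrm{pf}D$ ($\mathrm{pf}'A$) is the poset under inclusion of prime filters of a distributive lattice (Heyting algebra); on morphisms these act by inverse image. $\theta'_A(a)=\{\mathfrak{p}\in\mathrm{pf}'A\mid a\in\mathfrak{p}\}$. $\rho^\triangle_{(X,\le)}$ is the lattice homomorphism from $\mathsf{L}^\triangle(\mathrm{Up}(X,\le))$ to the lattice of upsets of $\mathsf{M}(X,\le)$ with $\dot\triangle a\mapsto\{W\mid a\in W\}$, and $(\rho^\triangle)^\flat_A:\mathsf{M}(\mathrm{pf}'A)\to\mathrm{pf}(\mathsf{L}^\triangle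 A)$ is $W\mapsto\{\ell\in\mathsf{L}^\triangle A\mid W\in\rho^\triangle_{\mathrm{pf}'A}((\mathsf{L}^\triangle\theta'_A)(\ell))\}$. An upset $D$ of $(\mathrm{pf}'A,\subseteq)$ is open if $D=\bigcup\{\theta'_A(a)\mid a\in A,\ \theta'_A(a)\subseteq D\}$. For $Q\in\mathrm{pf}(\mathsf{L}^\triangle A)$, $\sigma_A(Q)$ is defined by: an open upset $D$ is in $\sigma_A(Q)$ iff there is $a\in A$ with $\dot\triangle a\in Q$ and $\theta'_A(a)\subseteq D$; any other upset $D$ is in $\sigma_A(Q)$ iff all open upsets containing $D$ are in $\sigma_A(Q)$. Being a natural transformation means each $\sigma_A$ is order-preserving into $\mathsf{M}(\mathrm{pf}'A)$ and $\sigma_A\circ(\mathsf{L}^\triangle h)^{ -1}=\mathsf{M}(h^{ -1})\circ\sigma_B$ for every Heyting homomorphism $h:A\to B$. -}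

module Defs where

open import Level using (Level; 0ℓ; Lift; lift; lower) renaming (suc to lsuc)
open import Data.Product using (Σ; Σ-syntax; ∃; ∃-syntax; _×_; _,_; proj₁; proj₂)
open import Data.Sum using (_⊎_; inj₁; inj₂)
import Data.Unit as U
import Data.Empty as E
open import Relation.Nullary using (¬_)
open import Relation.Binary.Lattice.Bundles using (HeytingAlgebra)
open import Function using (_∘_)

HA : Set₁
HA = HeytingAlgebra 0ℓ 0ℓ 0ℓ

module _ (A B : HA) where
  private
    module A = HeytingAlgebra A
    module B = HeytingAlgebra B

  record IsHeytingHom (f : A.Carrier → B.Carrier) : Set where
    field
      cong  : ∀ {x y} → x A.≈ y → f x B.≈ f y
      ∧-hom : ∀ x y → f (x A.∧ y) B.≈ (f x B.∧ f y)
      ∨-hom : ∀ x y → f (x A.∨ y) B.≈ (f x B.∨ f y)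
      ⇨-hom : ∀ x y → f (x A.⇨ y) B.≈ (f x B.⇨ f y)
      ⊤-hom : f A.⊤ B.≈ B.⊤
      ⊥-hom : f A.⊥ B.≈ B.⊥

module _ (A : HA) where
  open HeytingAlgebra A

  record PF' : Set₁ where
    field
      P      : Carrier → Set
      up     : ∀ {x y} → x ≤ y → P x → P y
      top    : P ⊤
      meet   : ∀ {x y} → P x → P y → P (x ∧ y)
      proper : ¬ P ⊥
      prime  : ∀ {x y} → P (x ∨ y) → P x ⊎ P y

  record IsFilter (F : Carrier → Set) : Set where
    field
      up   : ∀ {x y} → x ≤ y → F x → F y
      top  : F ⊤
      meet : ∀ {x y} → F x → F y → F (x ∧ y)

  record IsIdeal (I : Carrier → Set) : Set where
    field
      down : ∀ {x y} → y ≤ x → I x → I y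
      bot  : I ⊥
      join : ∀ {x y} → I x → I y → I (x ∨ y)

open PF' public using (P)

_⊆pf'_ : {A : HA} → PF' A → PF' A → Set
p ⊆pf' q = ∀ x → P p x → P q x

PrimeFilterTheorem : Set₁
PrimeFilterTheorem =
  (A : HA) (F I : HeytingAlgebra.Carrier A → Set) →
  IsFilter A F → IsIdeal A I → (∀ x → F x → I x → E.⊥) →
  Σ[ p ∈ PF' A ] ((∀ x → F x → P p x) × (∀ x → P p x → I x → E.⊥))

record Upset (A : HA) : Set₂ where
  field
    D  : PF' A → Set₁
    up : ∀ {p q} → p ⊆pf' q → D p → D q

open Upset public using (D)

_⊆U_ : {A : HA} → Upset A → Upset A → Set₁
U ⊆U V = ∀ p → D U p → D V p

θ' : (A : HA) → HeytingAlgebra.Carrier A → Upset A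
θ' A a = record { D = λ p → Lift (lsuc 0ℓ) (P p a)
                ; up = λ p⊆q x → lift (p⊆q a (lower x)) }

IsOpen : {A : HA} → Upset A → Set₁
IsOpen {A} U =
  (∀ p → D U p → ∃[ a ] (θ' A a ⊆U U × D (θ' A a) p)) ×
  (∀ p → ∃[ a ] (θ' A a ⊆U U × D (θ' A a) p) → D U p)

infixr 7 _∧ᴸ_
infixr 6 _∨ᴸ_

data LTerm {ℓ : Level} (X : Set ℓ) : Set ℓ where
  ▵_  : X → LTerm X
  ⊤ᴸ  : LTerm X
  ⊥ᴸ  : LTerm X
  _∧ᴸ_ : LTerm X → LTerm X → LTerm X
  _∨ᴸ_ : LTerm X → LTerm X → LTerm X

mapL : {ℓ ℓ' : Level} {X : Set ℓ} {Y : Set ℓ'} → (X → Y) → LTerm X → LTerm Y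
mapL f (▵ x)    = ▵ (f x)
mapL f ⊤ᴸ       = ⊤ᴸ
mapL f ⊥ᴸ       = ⊥ᴸ
mapL f (x ∧ᴸ y) = mapL f x ∧ᴸ mapL f y
mapL f (x ∨ᴸ y) = mapL f x ∨ᴸ mapL f y

-- L^▵ A : terms over generators ▵a (a ∈ A) modulo the congruence
-- generated by the bounded distributive lattice axioms, the
-- relations ▵(a ∧ b) ≤ ▵a (written as ▵(a∧b) ∧ ▵a = ▵(a∧b)), and
-- ▵a = ▵b whenever a ≈ b in A.
module _ (A : HA) where
  open HeytingAlgebra A

  data LEq : LTerm Carrier → LTerm Carrier → Set where
    Lrefl   : ∀ {x} → LEq x x
    Lsym    : ∀ {x y} → LEq x y → LEq y x
    Ltrans  : ∀ {x y z} → LEq x y → LEq y z → LEq x z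
    L∧-cong : ∀ {x x' y y'} → LEq x x' → LEq y y' → LEq (x ∧ᴸ y) (x' ∧ᴸ y')
    L∨-cong : ∀ {x x' y y'} → LEq x x' → LEq y y' → LEq (x ∨ᴸ y) (x' ∨ᴸ y')
    L∧-comm : ∀ x y → LEq (x ∧ᴸ y) (y ∧ᴸ x)
    L∨-comm : ∀ x y → LEq (x ∨ᴸ y) (y ∨ᴸ x)
    L∧-assoc : ∀ x y z → LEq ((x ∧ᴸ y) ∧ᴸ z) (x ∧ᴸ (y ∧ᴸ z))
    L∨-assoc : ∀ x y z → LEq ((x ∨ᴸ y) ∨ᴸ z) (x ∨ᴸ (y ∨ᴸ z))
    L∧-absorbs-∨ : ∀ x y → LEq (x ∧ᴸ (x ∨ᴸ y)) x
    L∨-absorbs-∧ : ∀ x y → LEq (x ∨ᴸ (x ∧ᴸ y)) x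
    L∧-distrib-∨ : ∀ x y z → LEq (x ∧ᴸ (y ∨ᴸ z)) ((x ∧ᴸ y) ∨ᴸ (x ∧ᴸ z))
    L∧-⊤ : ∀ x → LEq (x ∧ᴸ ⊤ᴸ) x
    L∨-⊥ : ∀ x → LEq (x ∨ᴸ ⊥ᴸ) x
    L▵-cong : ∀ {a b} → a ≈ b → LEq (▵ a) (▵ b)
    L▵-mono : ∀ a b → LEq ((▵ (a ∧ b)) ∧ᴸ (▵ a)) (▵ (a ∧ b))

  _≤L_ : LTerm Carrier → LTerm Carrier → Set
  x ≤L y = LEq (x ∧ᴸ y) x

  record PFL : Set₁ where
    field
      Q      : LTerm Carrier → Set
      up     : ∀ {x y} → x ≤L y → Q x → Q y
      top    : Q ⊤ᴸ
      meet   : ∀ {x y} → Q x → Q y → Q (x ∧ᴸ y)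
      proper : ¬ Q ⊥ᴸ
      prime  : ∀ {x y} → Q (x ∨ᴸ y) → Q x ⊎ Q y

open PFL public using (Q)

_⊆pf_ : {A : HA} → PFL A → PFL A → Set
q ⊆pf q' = ∀ x → Q q x → Q q' x

module _ {A B : HA} {h : HeytingAlgebra.Carrier A → HeytingAlgebra.Carrier B}
         (hom : IsHeytingHom A B h) where
  private
    module A = HeytingAlgebra A
    module B = HeytingAlgebra B
    module H = IsHeytingHom hom

  hom-mono : ∀ {x y} → x A.≤ y → h x B.≤ h y
  hom-mono {x} {y} x≤y =
    B.trans (B.reflexive (B.Eq.trans (H.cong x≈x∧y) (H.∧-hom x y)))
            (B.x∧y≤y (h x) (h y))
    where
    x≈x∧y : x A.≈ (x A.∧ y)
    x≈x∧y = A.antisym (A.∧-greatest A.refl x≤y) (A.x∧y≤x x y)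

  pf'map : PF' B → PF' A
  pf'map p = record
    { P      = λ x → P p (h x)
    ; up     = λ x≤y → PF'.up p (hom-mono x≤y)
    ; top    = PF'.up p (B.reflexive (B.Eq.sym H.⊤-hom)) (PF'.top p)
    ; meet   = λ {x} {y} px py →
                 PF'.up p (B.reflexive (B.Eq.sym (H.∧-hom x y))) (PF'.meet p px py)
    ; proper = λ p⊥ → PF'.proper p (PF'.up p (B.reflexive H.⊥-hom) p⊥)
    ; prime  = λ {x} {y} pxy → PF'.prime p (PF'.up p (B.reflexive (H.∨-hom x y)) pxy)
    }

  pf'map-mono : ∀ {p q : PF' B} → p ⊆pf' q → pf'map p ⊆pf' pf'map q
  pf'map-mono p⊆q x = p⊆q (h x)

  mapL-cong : ∀ {x y} → LEq A x y → LEq B (mapL h x) (mapL h y)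
  mapL-cong Lrefl = Lrefl
  mapL-cong (Lsym e) = Lsym (mapL-cong e)
  mapL-cong (Ltrans e e') = Ltrans (mapL-cong e) (mapL-cong e')
  mapL-cong (L∧-cong e e') = L∧-cong (mapL-cong e) (mapL-cong e')
  mapL-cong (L∨-cong e e') = L∨-cong (mapL-cong e) (mapL-cong e')
  mapL-cong (L∧-comm x y) = L∧-comm _ _
  mapL-cong (L∨-comm x y) = L∨-comm _ _
  mapL-cong (L∧-assoc x y z) = L∧-assoc _ _ _
  mapL-cong (L∨-assoc x y z) = L∨-assoc _ _ _
  mapL-cong (L∧-absorbs-∨ x y) = L∧-absorbs-∨ _ _
  mapL-cong (L∨-absorbs-∧ x y) = L∨-absorbs-∧ _ _
  mapL-cong (L∧-distrib-∨ x y z) = L∧-distrib-∨ _ _ _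
  mapL-cong (L∧-⊤ x) = L∧-⊤ _
  mapL-cong (L∨-⊥ x) = L∨-⊥ _
  mapL-cong (L▵-cong e) = L▵-cong (H.cong e)
  mapL-cong (L▵-mono a b) =
    Ltrans (L∧-cong (L▵-cong (H.∧-hom a b)) Lrefl)
          (Ltrans (L▵-mono (h a) (h b)) (L▵-cong (B.Eq.sym (H.∧-hom a b))))

  pfLmap : PFL B → PFL A
  pfLmap q = record
    { Q      = λ x → Q q (mapL h x)
    ; up     = λ x≤y → PFL.up q (mapL-cong x≤y)
    ; top    = PFL.top q
    ; meet   = PFL.meet q
    ; proper = PFL.proper q
    ; prime  = PFL.prime q
    }

  preU : Upset A → Upset B
  preU U = record { D = λ p → D U (pf'map p)
                  ; up = λ {p} {q} p⊆q → Upset.up U (pf'map-mono {p} {q} p⊆q) }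

  Mmap : (Upset B → Set₂) → (Upset A → Set₂)
  Mmap W U = W (preU U)

σ-open : (A : HA) → PFL A → Upset A → Set₁
σ-open A q U = ∃[ a ] (Q q (▵ a) × θ' A a ⊆U U)

σ : (A : HA) → PFL A → Upset A → Set₂
σ A q U =
  (IsOpen U × σ-open A q U) ⊎
  (¬ IsOpen U × ((V : Upset A) → IsOpen V → U ⊆U V → σ-open A q V))

-- ρ^▵_{pf' A} : L^▵(Up(pf' A)) → Up(M(pf' A)), extended homomorphically
-- from ▵D ↦ { W | D ∈ W }; an element W of M(pf' A) is a family of upsets.
ρ : {A : HA} → LTerm (Upset A) → (Upset A → Set₂) → Set₂
ρ (▵ U)    W = W U
ρ ⊤ᴸ       W = Lift _ U.⊤
ρ ⊥ᴸ       W = Lift _ E.⊥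
ρ (x ∧ᴸ y) W = ρ x W × ρ y W
ρ (x ∨ᴸ y) W = ρ x W ⊎ ρ y W

ρ♭ : (A : HA) → (Upset A → Set₂) → LTerm (HeytingAlgebra.Carrier A) → Set₂
ρ♭ A W ℓ = ρ (mapL (θ' A) ℓ) W

-- Under excluded middle, σ_A(Q)(U) holds iff every open upset V ⊇ U contains some θ'(a)
-- with ▵a ∈ Q.  This reformulation is visibly upward closed in U and monotone in Q.
-- Everything else rests on compactness of the prime filter spectrum: if every prime
-- filter containing a filter F meets an ideal I, then F meets I.  This gives that θ'
-- reflects the order (hence (ρ^▵)^♭ ∘ σ = id on generators, and on all terms since Q is
-- a prime filter), and, for a Heyting homomorphism h, that a basic open θ'(b) inside
-- the preimage of an open V lies below some θ'(h a) with θ'(a) ⊆ V, and that every open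
-- W of pf' B has a largest open upset of pf' A whose preimage lies in W.  These two facts
-- transport σ along h.
module Submission where

open import Defs
open import Data.Product using (_×_)
open import Relation.Binary.Lattice.Bundles using (HeytingAlgebra)
open import Axiom.ExcludedMiddle using (ExcludedMiddle)

open import Level using (Level; lift; lower)
open import Data.Product using (∃-syntax; _,_; proj₁; proj₂)
open import Data.Sum using (inj₁; inj₂) renaming (map to ⊎-map)
open import Data.Empty using (⊥-elim)
open import Function using (_∘_)
open import Relation.Nullary using (yes; no)
open import Relation.Nullary.Decidable using (True; toWitness; fromWitness)

open HeytingAlgebra using (Carrier)

module _ {A : HA} where

  ⊆U-refl : (U : Upset A) → U ⊆U U
  ⊆U-refl U p Up = Up

  ⊆U-trans : (U V W : Upset A) → U ⊆U V → V ⊆U W → U ⊆U W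
  ⊆U-trans U V W U⊆V V⊆W p Up = V⊆W p (U⊆V p Up)

module LTermOrder (A : HA) where
  open HeytingAlgebra A using (_≤_; _≈_; _∧_; antisym; ∧-greatest; refl; x∧y≤y; module Eq)

  ∧ᴸ-idem : ∀ x → LEq A (x ∧ᴸ x) x
  ∧ᴸ-idem x = Ltrans (L∧-cong Lrefl (Lsym (L∨-absorbs-∧ x x))) (L∧-absorbs-∨ x (x ∧ᴸ x))

  x∧ᴸy≤x : ∀ x y → _≤L_ A (x ∧ᴸ y) x
  x∧ᴸy≤x x y = Ltrans (L∧-assoc x y x)
               (Ltrans (L∧-cong Lrefl (L∧-comm y x))
               (Ltrans (Lsym (L∧-assoc x x y)) (L∧-cong (∧ᴸ-idem x) Lrefl)))

  x∧ᴸy≤y : ∀ x y → _≤L_ A (x ∧ᴸ y) y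
  x∧ᴸy≤y x y = Ltrans (L∧-cong (L∧-comm x y) Lrefl) (Ltrans (x∧ᴸy≤x y x) (L∧-comm y x))

  x≤x∨ᴸy : ∀ x y → _≤L_ A x (x ∨ᴸ y)
  x≤x∨ᴸy = L∧-absorbs-∨

  y≤x∨ᴸy : ∀ x y → _≤L_ A y (x ∨ᴸ y)
  y≤x∨ᴸy x y = Ltrans (L∧-cong Lrefl (L∨-comm x y)) (L∧-absorbs-∨ y x)

  ▵-mono : ∀ {b a} → b ≤ a → _≤L_ A (▵ b) (▵ a)
  ▵-mono {b} {a} b≤a =
    Ltrans (L∧-cong (L▵-cong b≈a∧b) Lrefl) (Ltrans (L▵-mono a b) (L▵-cong (Eq.sym b≈a∧b)))
    where
    b≈a∧b : b ≈ (a ∧ b)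
    b≈a∧b = antisym (∧-greatest b≤a refl) (x∧y≤y a b)

module _ (A : HA) where
  open HeytingAlgebra A using (_≤_; _∨_; ⊥)

  θ'-⊥-⊆ : (U : Upset A) → θ' A ⊥ ⊆U U
  θ'-⊥-⊆ U p p∋⊥ = ⊥-elim (PF'.proper p (lower p∋⊥))

  θ'-∨-⊆ : (U : Upset A) {a b : Carrier A} →
           θ' A a ⊆U U → θ' A b ⊆U U → θ' A (a ∨ b) ⊆U U
  θ'-∨-⊆ U θa⊆U θb⊆U p p∋a∨b with PF'.prime p (lower p∋a∨b)
  ... | inj₁ p∋a = θa⊆U p (lift p∋a)
  ... | inj₂ p∋b = θb⊆U p (lift p∋b)

  θ'-antitone-⊆ : (U : Upset A) {a b : Carrier A} → a ≤ b → θ' A b ⊆U U → θ' A a ⊆U U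
  θ'-antitone-⊆ U a≤b θb⊆U p p∋a = θb⊆U p (lift (PF'.up p a≤b (lower p∋a)))

  ⋃θ'⊆ : (U : Upset A) (p : PF' A) → ∃[ a ] (θ' A a ⊆U U × D (θ' A a) p) → D U p
  ⋃θ'⊆ U p (a , θa⊆U , p∋a) = θa⊆U p p∋a

  θ'-open : (a : Carrier A) → IsOpen (θ' A a)
  θ'-open a = (λ p p∋a → a , ⊆U-refl (θ' A a) , p∋a) , ⋃θ'⊆ (θ' A a)

  σ-open-upward : (q : PFL A) (U V : Upset A) → U ⊆U V → σ-open A q U → σ-open A q V
  σ-open-upward q U V U⊆V (a , q∋▵a , θa⊆U) = a , q∋▵a , ⊆U-trans (θ' A a) U V θa⊆U U⊆V

module _ {A B : HA} {h : Carrier A → Carrier B} (hom : IsHeytingHom A B h) where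

  preU-open : (V : Upset A) → IsOpen V → IsOpen (preU hom V)
  preU-open V (cover , _) =
    (λ p h⁻¹p∈V → let (a , θa⊆V , lift p∋ha) = cover (pf'map hom p) h⁻¹p∈V
                  in h a , (λ p' → θa⊆V (pf'map hom p')) , lift p∋ha) ,
    ⋃θ'⊆ B (preU hom V)

  -- On open upsets this is right adjoint to preU hom (see preU⊆⇒⊆preU-adjoint).
  preU-adjoint : Upset B → Upset A
  preU-adjoint W = record
    { D  = λ p → ∃[ a ] (θ' B (h a) ⊆U W × P p a)
    ; up = λ p⊆p' (a , θha⊆W , p∋a) → a , θha⊆W , p⊆p' a p∋a
    }

  preU-adjoint-open : (W : Upset B) → IsOpen (preU-adjoint W)
  preU-adjoint-open W =
    (λ p (a , θha⊆W , p∋a) → a , (λ p' p'∋a → a , θha⊆W , lower p'∋a) , lift p∋a) ,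
    ⋃θ'⊆ A (preU-adjoint W)

  preU-preU-adjoint-⊆ : (W : Upset B) → preU hom (preU-adjoint W) ⊆U W
  preU-preU-adjoint-⊆ W p (a , θha⊆W , p∋ha) = θha⊆W p (lift p∋ha)

record IsIdealₗ {ℓ : Level} (A : HA) (I : Carrier A → Set ℓ) : Set ℓ where
  open HeytingAlgebra A using (_≤_; _∨_; ⊥)
  field
    down : ∀ {x y} → y ≤ x → I x → I y
    bot  : I ⊥
    join : ∀ {x y} → I x → I y → I (x ∨ y)

↑-isFilter : (A : HA) (b : Carrier A) → IsFilter A (HeytingAlgebra._≤_ A b)
↑-isFilter A b = record { up = λ x≤y b≤x → trans b≤x x≤y ; top = maximum b ; meet = ∧-greatest }
  where open HeytingAlgebra A

↓-isIdeal : (A : HA) (a : Carrier A) → IsIdealₗ A (λ x → HeytingAlgebra._≤_ A x a)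
↓-isIdeal A a = record { down = λ y≤x x≤a → trans y≤x x≤a ; bot = minimum a ; join = ∨-least }
  where open HeytingAlgebra A

θ'⊆-isIdeal : (A : HA) (U : Upset A) → IsIdealₗ A (λ y → θ' A y ⊆U U)
θ'⊆-isIdeal A U = record
  { down = θ'-antitone-⊆ A U ; bot = θ'-⊥-⊆ A U ; join = θ'-∨-⊆ A U }

module Classical (em : ∀ {ℓ} → ExcludedMiddle ℓ) (pft : PrimeFilterTheorem) where

  -- The prime filter theorem only accepts Set-valued ideals; excluded middle resizes
  -- a large predicate to the small type True (em {P = I x}).
  resize-ideal : ∀ {ℓ} {A : HA} {I : Carrier A → Set ℓ} →
                 IsIdealₗ A I → IsIdeal A (λ x → True (em {P = I x}))
  resize-ideal isI = record
    { down = λ y≤x Ix → fromWitness (down y≤x (toWitness Ix))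
    ; bot  = fromWitness bot
    ; join = λ Ix Iy → fromWitness (join (toWitness Ix) (toWitness Iy))
    }
    where open IsIdealₗ isI

  prime-filter-separation :
    ∀ {ℓ} (A : HA) {F : Carrier A → Set} {I : Carrier A → Set ℓ} →
    IsFilter A F → IsIdealₗ A I →
    ((p : PF' A) → (∀ x → F x → P p x) → ∃[ x ] (P p x × I x)) →
    ∃[ x ] (F x × I x)
  prime-filter-separation A {F} {I} isF isI meets with em {P = ∃[ x ] (F x × I x)}
  ... | yes F∩I = F∩I
  ... | no F∩I=∅ =
    let (p , F⊆p , p∩I=∅) = pft A F _ isF (resize-ideal isI)
                                (λ x Fx Ix → F∩I=∅ (x , Fx , toWitness Ix))
        (x , p∋x , Ix) = meets p F⊆p
    in ⊥-elim (p∩I=∅ x p∋x (fromWitness Ix))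

  θ'-reflects-≤ : (A : HA) {a b : Carrier A} → θ' A b ⊆U θ' A a → HeytingAlgebra._≤_ A b a
  θ'-reflects-≤ A {a} {b} θb⊆θa =
    let (x , b≤x , x≤a) = prime-filter-separation A (↑-isFilter A b) (↓-isIdeal A a)
                            (λ p ↑b⊆p → a , lower (θb⊆θa p (lift (↑b⊆p b refl))) , refl)
    in trans b≤x x≤a
    where open HeytingAlgebra A using (refl; trans)

  module _ {A B : HA} {h : Carrier A → Carrier B} (hom : IsHeytingHom A B h) where
    private
      module A = HeytingAlgebra A
      module B = HeytingAlgebra B

    θ'⊆preU⇒≤h : (V : Upset A) → IsOpen V → (b : Carrier B) → θ' B b ⊆U preU hom V →
                 ∃[ a ] (θ' A a ⊆U V × b B.≤ h a)
    θ'⊆preU⇒≤h V (cover , _) b θb⊆h⁻¹V =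
      let (y , b≤y , a , θa⊆V , y≤ha) =
            prime-filter-separation B (↑-isFilter B b) below-h[V] λ p ↑b⊆p →
              let (a , θa⊆V , lift p∋ha) = cover (pf'map hom p)
                                             (θb⊆h⁻¹V p (lift (↑b⊆p b B.refl)))
              in h a , p∋ha , a , θa⊆V , B.refl
      in a , θa⊆V , B.trans b≤y y≤ha
      where
      below-h[V] : IsIdealₗ B (λ y → ∃[ a ] (θ' A a ⊆U V × y B.≤ h a))
      below-h[V] = record
        { down = λ y≤x (a , θa⊆V , x≤ha) → a , θa⊆V , B.trans y≤x x≤ha
        ; bot  = A.⊥ , θ'-⊥-⊆ A V , B.minimum (h A.⊥)
        ; join = λ { (a , θa⊆V , x≤ha) (a' , θa'⊆V , y≤ha') →
            a A.∨ a' , θ'-∨-⊆ A V θa⊆V θa'⊆V ,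
            B.trans (B.∨-least (B.trans x≤ha (B.x≤x∨y (h a) (h a')))
                               (B.trans y≤ha' (B.y≤x∨y (h a) (h a'))))
                    (B.reflexive (B.Eq.sym (IsHeytingHom.∨-hom hom a a'))) }
        }

    preU⊆⇒⊆preU-adjoint : (U : Upset A) (W : Upset B) → IsOpen W →
                          preU hom U ⊆U W → U ⊆U preU-adjoint hom W
    preU⊆⇒⊆preU-adjoint U W (cover , _) h⁻¹U⊆W d d∈U =
      let (y , (x , d∋x , hx≤y) , θy⊆W) =
            prime-filter-separation B ↑h[d] (θ'⊆-isIdeal B W) λ p ↑h[d]⊆p →
              let h⁻¹p∈U = Upset.up U (λ x d∋x → ↑h[d]⊆p (h x) (x , d∋x , B.refl)) d∈U
                  (b , θb⊆W , lift p∋b) = cover p (h⁻¹U⊆W p h⁻¹p∈U)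
              in b , p∋b , θb⊆W
      in x , θ'-antitone-⊆ B W hx≤y θy⊆W , d∋x
      where
      ↑h[d] : IsFilter B (λ y → ∃[ x ] (P d x × h x B.≤ y))
      ↑h[d] = record
        { up   = λ y≤y' (x , d∋x , hx≤y) → x , d∋x , B.trans hx≤y y≤y'
        ; top  = A.⊤ , PF'.top d , B.maximum (h A.⊤)
        ; meet = λ { (x , d∋x , hx≤y) (x' , d∋x' , hx'≤y') →
            x A.∧ x' , PF'.meet d d∋x d∋x' ,
            B.trans (B.reflexive (IsHeytingHom.∧-hom hom x x'))
                    (B.∧-greatest (B.trans (B.x∧y≤x (h x) (h x')) hx≤y)
                                  (B.trans (B.x∧y≤y (h x) (h x')) hx'≤y')) }
        }

  σ∀ : (A : HA) → PFL A → Upset A → Set₂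
  σ∀ A q U = (V : Upset A) → IsOpen V → U ⊆U V → σ-open A q V

  σ→σ∀ : (A : HA) (q : PFL A) (U : Upset A) → σ A q U → σ∀ A q U
  σ→σ∀ A q U (inj₁ (_ , σ-open-U)) V _ U⊆V = σ-open-upward A q U V U⊆V σ-open-U
  σ→σ∀ A q U (inj₂ (_ , σ∀U)) = σ∀U

  σ∀→σ : (A : HA) (q : PFL A) (U : Upset A) → σ∀ A q U → σ A q U
  σ∀→σ A q U σ∀U with em {P = IsOpen U}
  ... | yes open-U = inj₁ (open-U , σ∀U U open-U (⊆U-refl U))
  ... | no ¬open-U = inj₂ (¬open-U , σ∀U)

  σ-upward : (A : HA) (q : PFL A) (U V : Upset A) → U ⊆U V → σ A q U → σ A q V
  σ-upward A q U V U⊆V σU =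
    σ∀→σ A q V λ W open-W V⊆W → σ→σ∀ A q U σU W open-W (⊆U-trans U V W U⊆V V⊆W)

  σ-mono : (A : HA) (q q' : PFL A) → q ⊆pf q' → (U : Upset A) → σ A q U → σ A q' U
  σ-mono A q q' q⊆q' U σU =
    σ∀→σ A q' U λ V open-V U⊆V →
      let (a , q∋▵a , θa⊆V) = σ→σ∀ A q U σU V open-V U⊆V in a , q⊆q' (▵ a) q∋▵a , θa⊆V

  module _ {A B : HA} {h : Carrier A → Carrier B} (hom : IsHeytingHom A B h) (q : PFL B) where

    σ∀-pfLmap⇒ : (U : Upset A) → σ∀ A (pfLmap hom q) U → σ∀ B q (preU hom U)
    σ∀-pfLmap⇒ U σ∀U W open-W h⁻¹U⊆W =
      let (a , q∋▵ha , θa⊆W') = σ∀U (preU-adjoint hom W) (preU-adjoint-open hom W)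
                                   (preU⊆⇒⊆preU-adjoint hom U W open-W h⁻¹U⊆W)
      in h a , q∋▵ha , λ p p∋ha →
           preU-preU-adjoint-⊆ hom W p (θa⊆W' (pf'map hom p) p∋ha)

    σ∀-pfLmap⇐ : (U : Upset A) → σ∀ B q (preU hom U) → σ∀ A (pfLmap hom q) U
    σ∀-pfLmap⇐ U σ∀h⁻¹U V open-V U⊆V =
      let (b , q∋▵b , θb⊆h⁻¹V) = σ∀h⁻¹U (preU hom V) (preU-open hom V open-V)
                                        (λ p → U⊆V (pf'map hom p))
          (a , θa⊆V , b≤ha) = θ'⊆preU⇒≤h hom V open-V b θb⊆h⁻¹V
      in a , PFL.up q (LTermOrder.▵-mono B b≤ha) q∋▵b , θa⊆V

    σ-natural⇒ : (U : Upset A) → σ A (pfLmap hom q) U → Mmap hom (σ B q) U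
    σ-natural⇒ U = σ∀→σ B q (preU hom U) ∘ σ∀-pfLmap⇒ U ∘ σ→σ∀ A (pfLmap hom q) U

    σ-natural⇐ : (U : Upset A) → Mmap hom (σ B q) U → σ A (pfLmap hom q) U
    σ-natural⇐ U = σ∀→σ A (pfLmap hom q) U ∘ σ∀-pfLmap⇐ U ∘ σ→σ∀ B q (preU hom U)

  module _ (A : HA) (q : PFL A) where
    open LTermOrder A

    σ-θ'⇒▵ : (a : Carrier A) → σ A q (θ' A a) → Q q (▵ a)
    σ-θ'⇒▵ a σθa =
      let (b , q∋▵b , θb⊆θa) = σ→σ∀ A q (θ' A a) σθa (θ' A a) (θ'-open A a) (⊆U-refl (θ' A a))
      in PFL.up q (▵-mono (θ'-reflects-≤ A θb⊆θa)) q∋▵b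

    ▵⇒σ-θ' : (a : Carrier A) → Q q (▵ a) → σ A q (θ' A a)
    ▵⇒σ-θ' a q∋▵a = σ∀→σ A q (θ' A a) λ V _ θa⊆V → a , q∋▵a , θa⊆V

    ρ♭-σ : (ℓ : LTerm (Carrier A)) → (ρ♭ A (σ A q) ℓ → Q q ℓ) × (Q q ℓ → ρ♭ A (σ A q) ℓ)
    ρ♭-σ (▵ a) = σ-θ'⇒▵ a , ▵⇒σ-θ' a
    ρ♭-σ ⊤ᴸ = (λ _ → PFL.top q) , (λ _ → lift _)
    ρ♭-σ ⊥ᴸ = (λ ()) , (⊥-elim ∘ PFL.proper q)
    ρ♭-σ (x ∧ᴸ y) =
      (λ (ρx , ρy) → PFL.meet q (proj₁ (ρ♭-σ x) ρx) (proj₁ (ρ♭-σ y) ρy)) ,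
      (λ q∋x∧y → proj₂ (ρ♭-σ x) (PFL.up q (x∧ᴸy≤x x y) q∋x∧y) ,
                 proj₂ (ρ♭-σ y) (PFL.up q (x∧ᴸy≤y x y) q∋x∧y))
    ρ♭-σ (x ∨ᴸ y) =
      (λ { (inj₁ ρx) → PFL.up q (x≤x∨ᴸy x y) (proj₁ (ρ♭-σ x) ρx)
         ; (inj₂ ρy) → PFL.up q (y≤x∨ᴸy x y) (proj₁ (ρ♭-σ y) ρy) }) ,
      (⊎-map (proj₂ (ρ♭-σ x)) (proj₂ (ρ♭-σ y)) ∘ PFL.prime q)

lemma4p12 :
    (∀ {ℓ} → ExcludedMiddle ℓ) → PrimeFilterTheorem →
    ((A : HA) (q : PFL A) (U V : Upset A) → U ⊆U V → σ A q U → σ A q V)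
    × ((A : HA) (q q' : PFL A) → q ⊆pf q' → (U : Upset A) → σ A q U → σ A q' U)
    × ((A B : HA) (h : HeytingAlgebra.Carrier A → HeytingAlgebra.Carrier B)
         (hom : IsHeytingHom A B h) (q : PFL B) (U : Upset A) →
         (σ A (pfLmap hom q) U → Mmap hom (σ B q) U)
         × (Mmap hom (σ B q) U → σ A (pfLmap hom q) U))
    × ((A : HA) (q : PFL A) (ℓ : LTerm (HeytingAlgebra.Carrier A)) →
         (ρ♭ A (σ A q) ℓ → Q q ℓ) × (Q q ℓ → ρ♭ A (σ A q) ℓ))
lemma4p12 em pft =
  σ-upward , σ-mono ,
  (λ A B h hom q U → σ-natural⇒ hom q U , σ-natural⇐ hom q U) ,
  ρ♭-σ
  where open Classical em pft
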